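{- Let $\mathcal{A}$ be a structure interpreting a binary relation symbol $f$ and a binary relation symbol $f^*$. Suppose that the universe of $\mathcal{A}$ is finite, that $f^{\mathcal{A}}$ is acyclic (there is no sequence $a_0,a_1,\dots,a_k$ with $k\ge 1$, $(a_{i},a_{i+1})\in f^{\mathcal{A}}$ for all $i<k$, and $a_k=a_0$), and that $\mathcal{A}\models T_1[f]$. Then $\mathcal{A}$ is a TC model, i.e., $(f^*)^{\mathcal{A}}$ is exactly the reflexive transitive closure of $f^{\mathcal{A}}$.
   Context: $f^*$ is a new binary relation symbol intended to stand for the reflexive transitive closure of $f$. The first-order axiom $T_1[f]$ is $\forall u,v\,.\, f^*(u,v) \leftrightarrow \big((u=v) \lor \exists w\,.\, f(u,w)\land f^*(w,v)\big)$. A TC model is a structure in which, for every binary symbol $f$ whose companion $f^*$ is in the vocabulary, $(f^*)^{\mathcal{A}}=(f^{\mathcal{A}})^\star$, the reflexive transitive closure. -}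

module Defs where

open import Level using (Level; _⊔_; suc)
open import Data.Nat using (ℕ; _≤_)
open import Data.Fin using (Fin; zero; inject₁; fromℕ) renaming (suc to fsuc)
open import Data.Product using (Σ; ∃; _×_)
open import Data.Sum using (_⊎_)
open import Relation.Nullary using (¬_)
open import Relation.Binary.PropositionalEquality using (_≡_)
open import Relation.Binary.Construct.Closure.ReflexiveTransitive using (Star)
open import Function.Bundles using (_↔_; _⇔_)

record Structure (a ℓ : Level) : Set (Level.suc (a ⊔ ℓ)) where
  field
    U     : Set a
    f     : U → U → Set ℓ
    fstar : U → U → Set ℓ
open Structure public

FiniteUniverse : ∀ {a ℓ} → Structure a ℓ → Set a
FiniteUniverse 𝒜 = Σ ℕ λ n → Fin n ↔ U 𝒜

Acyclic : ∀ {a ℓ} {A : Set a} → (A → A → Set ℓ) → Set (a ⊔ ℓ)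
Acyclic {A = A} R =
  ∀ (k : ℕ) → 1 ≤ k → (s : Fin (ℕ.suc k) → A) →
    ((i : Fin k) → R (s (inject₁ i)) (s (fsuc i))) →
    ¬ (s (fromℕ k) ≡ s zero)

SatisfiesT1 : ∀ {a ℓ} → Structure a ℓ → Set (a ⊔ ℓ)
SatisfiesT1 𝒜 =
  ∀ (u v : U 𝒜) → fstar 𝒜 u v ⇔ ((u ≡ v) ⊎ ∃ λ w → f 𝒜 u w × fstar 𝒜 w v)

IsTCModel : ∀ {a ℓ} → Structure a ℓ → Set (a ⊔ ℓ)
IsTCModel 𝒜 = ∀ (u v : U 𝒜) → fstar 𝒜 u v ⇔ Star (f 𝒜) u v

-- Unfolding T₁[f] from f*(u,v) either reaches v along an f-path, or
-- produces arbitrarily long f-paths starting at u.  In a universe of n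
-- elements a path of length n repeats a node by pigeonhole, and the
-- segment between the repetitions is a cycle, which acyclicity forbids.
-- Conversely, the closure is contained in f* because f* is reflexive and
-- closed under prepending an f-step, again by T₁[f].
module Submission where

open import Defs
open import Level using (Level; _⊔_)
open import Data.Nat using (ℕ; suc; _≤_; z≤n; s≤s)
open import Data.Nat.Properties using (≤-refl)
open import Data.Fin using (Fin; zero; inject₁; fromℕ) renaming (suc to fsuc; _<_ to _<ᶠ_)
open import Data.Fin.Properties using (pigeonhole)
open import Data.Product using (∃; ∃₂; _,_)
open import Data.Sum using (_⊎_; inj₁; inj₂)
open import Data.Empty using (⊥-elim)
open import Relation.Nullary using (¬_)
open import Relation.Binary.Core using (Rel)
open import Relation.Binary.PropositionalEquality using (_≡_; refl; sym; subst)
open import Relation.Binary.Construct.Closure.ReflexiveTransitive using (Star; ε; _◅_)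
open import Function using (_∘_)
open import Function.Bundles using (_↣_; Injection; Equivalence; mk⇔)
open import Function.Properties.Inverse using (↔⇒↣; ↔-sym)

module _ {a ℓ : Level} {A : Set a} (R : Rel A ℓ) where

  data Path : ℕ → A → A → Set (a ⊔ ℓ) where
    []  : ∀ {u} → Path 0 u u
    _∷_ : ∀ {m u w v} → R u w → Path m w v → Path (suc m) u v

  Cycle : Set (a ⊔ ℓ)
  Cycle = ∃₂ λ m y → Path (suc m) y y

  nodes : ∀ {m u v} → Path m u v → Fin (suc m) → A
  nodes {u = u} p       zero     = u
  nodes         (r ∷ p) (fsuc i) = nodes p i

  nodes-last : ∀ {m u v} (p : Path m u v) → nodes p (fromℕ m) ≡ v
  nodes-last []      = refl
  nodes-last (r ∷ p) = nodes-last p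

  nodes-steps : ∀ {m u v} (p : Path m u v) (i : Fin m) →
                R (nodes p (inject₁ i)) (nodes p (fsuc i))
  nodes-steps (r ∷ p) zero     = r
  nodes-steps (r ∷ p) (fsuc i) = nodes-steps p i

  prefix : ∀ {m u v} (p : Path m u v) (j : Fin (suc m)) → ∃ λ k → Path k u (nodes p j)
  prefix p       zero     = 0 , []
  prefix (r ∷ p) (fsuc j) with k , q ← prefix p j = suc k , r ∷ q

  repeated-node⇒cycle : ∀ {m u v} (p : Path m u v) {i j : Fin (suc m)} →
                        i <ᶠ j → nodes p i ≡ nodes p j → Cycle
  repeated-node⇒cycle (r ∷ p) {zero}   {fsuc j} _         u≡pⱼ
    with k , q ← prefix p j = k , _ , r ∷ subst (Path k _) (sym u≡pⱼ) q
  repeated-node⇒cycle (r ∷ p) {fsuc i} {fsuc j} (s≤s i<j) pᵢ≡pⱼ =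
    repeated-node⇒cycle p i<j pᵢ≡pⱼ

  long-path⇒cycle : ∀ {n m u v} → A ↣ Fin n → n ≤ m → Path m u v → Cycle
  long-path⇒cycle ι n≤m p
    with i , j , i<j , ιpᵢ≡ιpⱼ ← pigeonhole (s≤s n≤m) (Injection.to ι ∘ nodes p) =
    repeated-node⇒cycle p i<j (Injection.injective ι ιpᵢ≡ιpⱼ)

  acyclic⇒¬cycle : Acyclic R → ¬ Cycle
  acyclic⇒¬cycle acyclic (m , y , p) =
    acyclic (suc m) (s≤s z≤n) (nodes p) (nodes-steps p) (nodes-last p)

module _ {a ℓ : Level} (𝒜 : Structure a ℓ) (t1 : SatisfiesT1 𝒜) where

  star⇒fstar : ∀ {u v} → Star (f 𝒜) u v → fstar 𝒜 u v
  star⇒fstar {u} {v} ε       = Equivalence.from (t1 u v) (inj₁ refl)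
  star⇒fstar {u} {v} (r ◅ q) = Equivalence.from (t1 u v) (inj₂ (_ , r , star⇒fstar q))

  fstar⇒star-or-path : ∀ m {u v} → fstar 𝒜 u v →
                       Star (f 𝒜) u v ⊎ ∃ λ x → Path (f 𝒜) m u x
  fstar⇒star-or-path 0       {u} _ = inj₂ (u , [])
  fstar⇒star-or-path (suc m) {u} {v} s with Equivalence.to (t1 u v) s
  ... | inj₁ refl            = inj₁ ε
  ... | inj₂ (w , r , s′) with fstar⇒star-or-path m s′
  ...   | inj₁ q       = inj₁ (r ◅ q)
  ...   | inj₂ (x , p) = inj₂ (x , r ∷ p)

proposition3p1 : ∀ {a ℓ : Level} (𝒜 : Structure a ℓ) →
    FiniteUniverse 𝒜 → Acyclic (f 𝒜) → SatisfiesT1 𝒜 → IsTCModel 𝒜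
proposition3p1 𝒜 (n , Fin↔U) acyclic t1 u v = mk⇔ fstar⇒star (star⇒fstar 𝒜 t1)
  where
    fstar⇒star : fstar 𝒜 u v → Star (f 𝒜) u v
    fstar⇒star s with fstar⇒star-or-path 𝒜 t1 n s
    ... | inj₁ q       = q
    ... | inj₂ (_ , p) =
      ⊥-elim (acyclic⇒¬cycle (f 𝒜) acyclic
               (long-path⇒cycle (f 𝒜) (↔⇒↣ (↔-sym Fin↔U)) ≤-refl p))
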